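{- Let $\mathcal{P}\subset\mathbb{Q}$ be a finite arithmetic progression such that $\mathcal{P}\setminus\{0\}=\mathcal{A}\mathcal{B}$ for some sets $\mathcal{A}\subset\mathbb{Q}$, $\mathcal{B}\subset\mathbb{Q}$ with $|\mathcal{A}|\ge2$ and $|\mathcal{B}|\ge2$. Then there exist rational numbers $r,r_1,r_2$ such that either $\mathcal{A}=\{ -r_1,2r_1\}$ and $\mathcal{B}=\{ -r_2,2r_2\}$, or one of the sets $\mathcal{A}$ or $\mathcal{B}$ coincides with the set $\{ -r,r\}$.
   Context: For $\mathcal{A},\mathcal{B}\subset\mathbb{Q}$, $\mathcal{A}\mathcal{B}=\{ab:\ a\in\mathcal{A},\ b\in\mathcal{B}\}$. -}

module Defs where

open import Level using (0ℓ)
open import Data.Nat as ℕ using (ℕ)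
open import Data.Integer using (+_)
open import Data.Rational using (ℚ; _+_; _*_; -_; _/_)
open import Data.Product using (Σ; ∃; ∃-syntax; _×_; _,_)
open import Relation.Unary using (Pred; _∈_; _≐_)
open import Relation.Binary.PropositionalEquality using (_≡_; _≢_)

ℕ→ℚ : ℕ → ℚ
ℕ→ℚ k = + k / 1

AP : ℚ → ℚ → ℕ → Pred ℚ 0ℓ
AP a d n x = ∃[ k ] (k ℕ.< n × x ≡ a + ℕ→ℚ k * d)

IsFiniteAP : Pred ℚ 0ℓ → Set
IsFiniteAP P = ∃[ a ] ∃[ d ] ∃[ n ] (P ≐ AP a d n)

_·ˢ_ : Pred ℚ 0ℓ → Pred ℚ 0ℓ → Pred ℚ 0ℓ
(A ·ˢ B) x = ∃[ a ] ∃[ b ] (a ∈ A × b ∈ B × x ≡ a * b)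

AtLeastTwo : Pred ℚ 0ℓ → Set
AtLeastTwo A = ∃[ x ] ∃[ y ] (x ∈ A × y ∈ A × x ≢ y)

-- After scaling A by a suitable factor, and reversing the progression if necessary, P ∖ {0} = AB
-- becomes {u - k : k ≤ m} ∖ {0} with 0 < u and m ≤ 2u, so that u is a term of largest absolute value.
-- For y, y′ ∈ A and c, c′ ∈ B the identity (yc)(y′c′) = (yc′)(y′c) between terms u - p, u - q, u - r,
-- u - s reads pq - rs = (p + q - r - s) u, and since all indices are at most 2u such relations pin the
-- indices down. Write u = xb. If u = 1 every product is ±u, so A = {±x}. Otherwise u - 1 = x′b′; if
-- b′ = b (or x′ = x) the relation for x c and x′ c forces c = ±b (or y = ±x). If not, xb′ = u - i and
-- x′b = u - j with ij + u = (i + j) u, whence |i - j| ≤ 1. For j = i + 1 (or i = j + 1) one finds A = {±x}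
-- (or B = {±b}). For i = j ≥ 2, A ⊆ {x, x′} and B ⊆ {b, b′}, so u - 2 is not a product unless i = 2;
-- then u = 4/3, x = -2x′ and b = -2b′.

module Submission where

open import Level using (0ℓ)
open import Data.Empty using (⊥; ⊥-elim)
import Data.Integer as ℤ
import Data.Integer.Properties as ℤ
open import Data.Nat as ℕ using (ℕ; zero; suc; z≤n; s≤s)
import Data.Nat.Properties as ℕ
open import Data.Nat.Coprimality using (gcd≡1⇒coprime)
open import Data.Nat.GCD using (gcd-zeroʳ)
open import Data.Nat.Tactic.RingSolver using (solve-∀)
open import Data.Product using (∃-syntax; _×_; _,_; proj₁; proj₂)
open import Data.Rational
  using (ℚ; mkℚ; toℚᵘ; _+_; _*_; -_; _-_; 1/_; 0ℚ; 1ℚ; _≤_; _<_; _≟_; _≤?_; NonZero; ≢-nonZero; positive; nonNegative)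
open import Data.Rational.Properties
open import Data.Rational.Solver using (module +-*-Solver)
import Data.Rational.Unnormalised as ℚᵘ
import Data.Rational.Unnormalised.Properties as ℚᵘ
open import Data.Sum using (_⊎_; inj₁; inj₂; [_,_]′)
open import Relation.Binary using (Tri; tri<; tri≈; tri>)
open import Relation.Binary.PropositionalEquality
open import Relation.Nullary using (Dec; yes; no)
open import Relation.Unary using (Pred; _∈_; _⊆_; _≐_; ｛_｝; _∪_; _∖_)
open import Relation.Unary.Properties using (≐-sym; ≐-trans)

open import Defs

open +-*-Solver using (solve; _:=_; con; _:+_; _:*_; _:-_; :-_)
open import Algebra.Properties.Group +-0-group using (x∙y⁻¹≈ε⇒x≈y; x≈y⇒x∙y⁻¹≈ε; ⁻¹-involutive)

variable
  A B S : Pred ℚ 0ℓ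
  a b b′ c d r s t u w w′ x x′ y μ : ℚ
  i j k m n : ℕ

*-cancelˡ-≡ : ∀ {p q} r → r ≢ 0ℚ → r * p ≡ r * q → p ≡ q
*-cancelˡ-≡ {p} {q} r r≢0 eq = begin
  p               ≡⟨ sym (*-identityˡ p) ⟩
  1ℚ * p          ≡⟨ cong (_* p) (sym (*-inverseˡ r)) ⟩
  (1/ r * r) * p  ≡⟨ *-assoc (1/ r) r p ⟩
  1/ r * (r * p)  ≡⟨ cong (1/ r *_) eq ⟩
  1/ r * (r * q)  ≡⟨ sym (*-assoc (1/ r) r q) ⟩
  (1/ r * r) * q  ≡⟨ cong (_* q) (*-inverseˡ r) ⟩
  1ℚ * q          ≡⟨ *-identityˡ q ⟩
  q               ∎
  where
  open ≡-Reasoning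
  instance _ = ≢-nonZero r≢0

*-cancelʳ-≡ : ∀ {p q} r → r ≢ 0ℚ → p * r ≡ q * r → p ≡ q
*-cancelʳ-≡ {p} {q} r r≢0 eq = *-cancelˡ-≡ r r≢0 (trans (*-comm r p) (trans eq (*-comm q r)))

≡-by-difference : ∀ {p q r s} c → p - q ≡ c * (r - s) → r ≡ s → p ≡ q
≡-by-difference {p} {q} c eq r≡s = x∙y⁻¹≈ε⇒x≈y p q
  (trans eq (trans (cong (c *_) (x≈y⇒x∙y⁻¹≈ε r≡s)) (*-zeroʳ c)))

≡-by-difference₂ : ∀ {p q r s r′ s′} c c′ → p - q ≡ c * (r - s) + c′ * (r′ - s′) → r ≡ s → r′ ≡ s′ → p ≡ q
≡-by-difference₂ {p} {q} c c′ eq r≡s r′≡s′ = x∙y⁻¹≈ε⇒x≈y p q (trans eq (trans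
  (cong₂ (λ z z′ → c * z + c′ * z′) (x≈y⇒x∙y⁻¹≈ε r≡s) (x≈y⇒x∙y⁻¹≈ε r′≡s′))
  (cong₂ _+_ (*-zeroʳ c) (*-zeroʳ c′))))

p≤q⇒0≤q-p : ∀ {p q} → p ≤ q → 0ℚ ≤ q - p
p≤q⇒0≤q-p {p} {q} p≤q = ≤-trans (≤-reflexive (sym (+-inverseʳ p))) (+-monoˡ-≤ (- p) p≤q)

doubled-negative : b ≢ 0ℚ → x * b ≡ w → x′ * b ≡ w′ → - (w′ + w′) ≡ w → x ≡ (1ℚ + 1ℚ) * - x′
doubled-negative {b} {x} {w} {x′} {w′} b≢0 xb≡w x′b≡w′ eq = *-cancelʳ-≡ b b≢0 (begin
  x * b                      ≡⟨ xb≡w ⟩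
  w                          ≡⟨ sym eq ⟩
  - (w′ + w′)                ≡⟨ cong (λ z → - (z + z)) (sym x′b≡w′) ⟩
  - (x′ * b + x′ * b)        ≡⟨ solve 2 (λ x′ b → :- (x′ :* b :+ x′ :* b) := (con 1ℚ :+ con 1ℚ) :* (:- x′) :* b) refl x′ b ⟩
  (1ℚ + 1ℚ) * - x′ * b       ∎)
  where open ≡-Reasoning

toℚᵘ-ℕ→ℚ : ∀ n → toℚᵘ (ℕ→ℚ n) ≡ ℚᵘ.mkℚᵘ (ℤ.+ n) 0
toℚᵘ-ℕ→ℚ n = cong toℚᵘ (↥p/↧p≡p (mkℚ (ℤ.+ n) 0 (gcd≡1⇒coprime (gcd-zeroʳ n))))

ℕ→ℚ-homo-+ : ∀ m n → ℕ→ℚ (m ℕ.+ n) ≡ ℕ→ℚ m + ℕ→ℚ n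
ℕ→ℚ-homo-+ m n = toℚᵘ-injective (begin
  toℚᵘ (ℕ→ℚ (m ℕ.+ n))                     ≡⟨ toℚᵘ-ℕ→ℚ (m ℕ.+ n) ⟩
  ℚᵘ.mkℚᵘ (ℤ.+ (m ℕ.+ n)) 0                 ≈⟨ ℚᵘ.*≡* (trans (ℤ.*-identityʳ _) (trans (ℤ.pos-+ m n) (sym (trans (ℤ.*-identityʳ _)
                                                 (cong₂ ℤ._+_ (ℤ.*-identityʳ (ℤ.+ m)) (ℤ.*-identityʳ (ℤ.+ n))))))) ⟩
  ℚᵘ.mkℚᵘ (ℤ.+ m) 0 ℚᵘ.+ ℚᵘ.mkℚᵘ (ℤ.+ n) 0  ≡⟨ sym (cong₂ ℚᵘ._+_ (toℚᵘ-ℕ→ℚ m) (toℚᵘ-ℕ→ℚ n)) ⟩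
  toℚᵘ (ℕ→ℚ m) ℚᵘ.+ toℚᵘ (ℕ→ℚ n)            ≈⟨ ℚᵘ.≃-sym (toℚᵘ-homo-+ (ℕ→ℚ m) (ℕ→ℚ n)) ⟩
  toℚᵘ (ℕ→ℚ m + ℕ→ℚ n)                      ∎)
  where open ℚᵘ.≃-Reasoning

ℕ→ℚ-homo-* : ∀ m n → ℕ→ℚ (m ℕ.* n) ≡ ℕ→ℚ m * ℕ→ℚ n
ℕ→ℚ-homo-* m n = toℚᵘ-injective (begin
  toℚᵘ (ℕ→ℚ (m ℕ.* n))                     ≡⟨ toℚᵘ-ℕ→ℚ (m ℕ.* n) ⟩
  ℚᵘ.mkℚᵘ (ℤ.+ (m ℕ.* n)) 0                 ≈⟨ ℚᵘ.*≡* (trans (ℤ.*-identityʳ _) (trans (ℤ.pos-* m n) (sym (ℤ.*-identityʳ _)))) ⟩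
  ℚᵘ.mkℚᵘ (ℤ.+ m) 0 ℚᵘ.* ℚᵘ.mkℚᵘ (ℤ.+ n) 0  ≡⟨ sym (cong₂ ℚᵘ._*_ (toℚᵘ-ℕ→ℚ m) (toℚᵘ-ℕ→ℚ n)) ⟩
  toℚᵘ (ℕ→ℚ m) ℚᵘ.* toℚᵘ (ℕ→ℚ n)            ≈⟨ ℚᵘ.≃-sym (toℚᵘ-homo-* (ℕ→ℚ m) (ℕ→ℚ n)) ⟩
  toℚᵘ (ℕ→ℚ m * ℕ→ℚ n)                      ∎)
  where open ℚᵘ.≃-Reasoning

ℕ→ℚ-suc : ∀ n → ℕ→ℚ (suc n) ≡ 1ℚ + ℕ→ℚ n
ℕ→ℚ-suc = ℕ→ℚ-homo-+ 1

ℕ→ℚ-mono-≤ : m ℕ.≤ n → ℕ→ℚ m ≤ ℕ→ℚ n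
ℕ→ℚ-mono-≤ {m} {n} m≤n = toℚᵘ-cancel-≤ (subst₂ ℚᵘ._≤_ (sym (toℚᵘ-ℕ→ℚ m)) (sym (toℚᵘ-ℕ→ℚ n))
  (ℚᵘ.*≤* (subst₂ ℤ._≤_ (sym (ℤ.*-identityʳ _)) (sym (ℤ.*-identityʳ _)) (ℤ.+≤+ m≤n))))

ℕ→ℚ-cancel-≤ : ℕ→ℚ m ≤ ℕ→ℚ n → m ℕ.≤ n
ℕ→ℚ-cancel-≤ {m} {n} le with subst₂ ℚᵘ._≤_ (toℚᵘ-ℕ→ℚ m) (toℚᵘ-ℕ→ℚ n) (toℚᵘ-mono-≤ le)
... | ℚᵘ.*≤* le′ = ℤ.drop‿+≤+ (subst₂ ℤ._≤_ (ℤ.*-identityʳ _) (ℤ.*-identityʳ _) le′)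

ℕ→ℚ-injective : ℕ→ℚ m ≡ ℕ→ℚ n → m ≡ n
ℕ→ℚ-injective eq = ℕ.≤-antisym (ℕ→ℚ-cancel-≤ (≤-reflexive eq)) (ℕ→ℚ-cancel-≤ (≤-reflexive (sym eq)))

ℕ→ℚ-nonNeg : ∀ n → 0ℚ ≤ ℕ→ℚ n
ℕ→ℚ-nonNeg n = ℕ→ℚ-mono-≤ {n = n} z≤n

ℕ→ℚ-≢0 : n ≢ 0 → ℕ→ℚ n ≢ 0ℚ
ℕ→ℚ-≢0 n≢0 eq = n≢0 (ℕ→ℚ-injective eq)

ℕ→ℚ-multiple : ∀ a b c → 0ℚ ≤ w → ℕ→ℚ a + ℕ→ℚ c * w ≡ ℕ→ℚ b * w → ∃[ e ] ℕ→ℚ a ≡ ℕ→ℚ e * w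
ℕ→ℚ-multiple {w} a b c 0≤w eq with ℕ.≤-total c b
... | inj₁ c≤b = b ℕ.∸ c , ≡-by-difference 1ℚ
  (solve 4 (λ A C E w → A :- E :* w := con 1ℚ :* ((A :+ C :* w) :- (C :+ E) :* w)) refl (ℕ→ℚ a) (ℕ→ℚ c) (ℕ→ℚ (b ℕ.∸ c)) w)
  (trans eq (cong (_* w) (trans (cong ℕ→ℚ (sym (ℕ.m+[n∸m]≡n c≤b))) (ℕ→ℚ-homo-+ c (b ℕ.∸ c)))))
... | inj₂ b≤c = 0 , trans (≤-antisym a≤0 (ℕ→ℚ-nonNeg a)) (sym (*-zeroˡ w))
  where
  gap : ℕ
  gap = c ℕ.∸ b
  sum≡0 : ℕ→ℚ a + ℕ→ℚ gap * w ≡ 0ℚ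
  sum≡0 = ≡-by-difference 1ℚ
    (solve 4 (λ A B T w → (A :+ T :* w) :- con 0ℚ := con 1ℚ :* ((A :+ (B :+ T) :* w) :- B :* w)) refl (ℕ→ℚ a) (ℕ→ℚ b) (ℕ→ℚ gap) w)
    (trans (sym (cong (λ z → ℕ→ℚ a + z * w) (trans (cong ℕ→ℚ (sym (ℕ.m+[n∸m]≡n b≤c))) (ℕ→ℚ-homo-+ b gap)))) eq)
  a≤0 : ℕ→ℚ a ≤ 0ℚ
  a≤0 = ≤-trans (≤-trans (≤-reflexive (sym (+-identityʳ (ℕ→ℚ a))))
                          (+-monoʳ-≤ (ℕ→ℚ a) (nonNegative⁻¹ _ {{nonNeg*nonNeg⇒nonNeg (ℕ→ℚ gap) {{nonNegative (ℕ→ℚ-nonNeg gap)}} w {{nonNegative 0≤w}}}})))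
                (≤-reflexive sum≡0)

adjacent-or-equal : i ℕ.≤ suc j → j ℕ.≤ suc i → j ≡ suc i ⊎ i ≡ suc j ⊎ i ≡ j
adjacent-or-equal {i} {j} i≤1+j j≤1+i with ℕ.<-cmp i j
... | tri< i<j _ _ = inj₁ (ℕ.≤-antisym j≤1+i i<j)
... | tri≈ _ i≡j _ = inj₂ (inj₂ i≡j)
... | tri> _ _ j<i = inj₂ (inj₁ (ℕ.≤-antisym i≤1+j j<i))

≢0∧≢1⇒≥2 : n ≢ 0 → n ≢ 1 → 2 ℕ.≤ n
≢0∧≢1⇒≥2 {zero} n≢0 _ = ⊥-elim (n≢0 refl)
≢0∧≢1⇒≥2 {suc zero} _ n≢1 = ⊥-elim (n≢1 refl)
≢0∧≢1⇒≥2 {suc (suc n)} _ _ = s≤s (s≤s z≤n)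

at-most-one : ∀ {i e} → 2 ℕ.≤ i → i ℕ.* (e ℕ.* i) ℕ.+ i ℕ.* (e ℕ.* i) ℕ.≤ i ℕ.* i ℕ.+ i ℕ.* i ℕ.+ e ℕ.* i → e ℕ.≤ 1
at-most-one {e = zero} _ _ = z≤n
at-most-one {e = suc zero} _ _ = s≤s z≤n
at-most-one {suc zero} {suc (suc _)} (s≤s ()) _
at-most-one {suc (suc i)} {suc (suc e)} _ le = ⊥-elim (ℕ.m+1+n≰m _ (ℕ.≤-trans (ℕ.≤-reflexive (sym (excess i e))) le))
  where
  excess : ∀ i e → let I = 2 ℕ.+ i; E = 2 ℕ.+ e in
    I ℕ.* (E ℕ.* I) ℕ.+ I ℕ.* (E ℕ.* I)
      ≡ (I ℕ.* I ℕ.+ I ℕ.* I ℕ.+ E ℕ.* I) ℕ.+ suc (3 ℕ.+ 6 ℕ.* i ℕ.+ 6 ℕ.* e ℕ.+ 7 ℕ.* i ℕ.* e ℕ.+ 2 ℕ.* i ℕ.* i ℕ.+ 2 ℕ.* i ℕ.* i ℕ.* e)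
  excess = solve-∀

no-root : ∀ i → i ℕ.* i ℕ.+ 2 ≢ (i ℕ.+ i) ℕ.* 2
no-root 0 ()
no-root 1 ()
no-root 2 ()
no-root 3 ()
no-root (suc (suc (suc (suc s)))) eq = ℕ.m+1+n≢m _ (trans (sym (excess s)) eq)
  where
  excess : ∀ s → let I = 4 ℕ.+ s in I ℕ.* I ℕ.+ 2 ≡ (I ℕ.+ I) ℕ.* 2 ℕ.+ suc (1 ℕ.+ 4 ℕ.* s ℕ.+ s ℕ.* s)
  excess = solve-∀

±-pair : ℚ → Pred ℚ 0ℓ
±-pair r = ｛ - r ｝ ∪ ｛ r ｝

doubling-pair : ℚ → Pred ℚ 0ℓ
doubling-pair r = ｛ - r ｝ ∪ ｛ (1ℚ + 1ℚ) * r ｝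

Conclusion : Pred ℚ 0ℓ → Pred ℚ 0ℓ → Set
Conclusion A B = ∃[ r ] ∃[ r₁ ] ∃[ r₂ ]
  ((A ≐ doubling-pair r₁ × B ≐ doubling-pair r₂) ⊎ (A ≐ ±-pair r ⊎ B ≐ ±-pair r))

conclusion-±ˡ : A ≐ ±-pair r → Conclusion A B
conclusion-±ˡ {r = r} A≐ = r , 0ℚ , 0ℚ , inj₂ (inj₁ A≐)

conclusion-±ʳ : B ≐ ±-pair r → Conclusion A B
conclusion-±ʳ {r = r} B≐ = r , 0ℚ , 0ℚ , inj₂ (inj₂ B≐)

conclusion-doubling : A ≐ doubling-pair r → B ≐ doubling-pair s → Conclusion A B
conclusion-doubling {r = r} {s = s} A≐ B≐ = 0ℚ , r , s , inj₁ (A≐ , B≐)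

⊆-pair∧∈⇒≐ : S ⊆ ｛ s ｝ ∪ ｛ t ｝ → s ∈ S → t ∈ S → S ≐ ｛ s ｝ ∪ ｛ t ｝
⊆-pair∧∈⇒≐ S⊆ s∈S t∈S = S⊆ , λ { (inj₁ refl) → s∈S ; (inj₂ refl) → t∈S }

⊆-pair∧two⇒≐ : S ⊆ ｛ s ｝ ∪ ｛ t ｝ → AtLeastTwo S → S ≐ ｛ s ｝ ∪ ｛ t ｝
⊆-pair∧two⇒≐ {S} S⊆ (y , y′ , y∈S , y′∈S , y≢y′) with S⊆ y∈S | S⊆ y′∈S
... | inj₁ refl | inj₁ refl = ⊥-elim (y≢y′ refl)
... | inj₁ refl | inj₂ refl = ⊆-pair∧∈⇒≐ S⊆ y∈S y′∈S
... | inj₂ refl | inj₁ refl = ⊆-pair∧∈⇒≐ S⊆ y′∈S y∈S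
... | inj₂ refl | inj₂ refl = ⊥-elim (y≢y′ refl)

⊆-pair⇒≐-doubling-pair : S ⊆ ｛ x ｝ ∪ ｛ x′ ｝ → x ∈ S → x′ ∈ S → x ≡ (1ℚ + 1ℚ) * - x′ → S ≐ doubling-pair (- x′)
⊆-pair⇒≐-doubling-pair {S} {x} {x′} S⊆ x∈S x′∈S x≡ = ⊆-pair∧∈⇒≐
  (λ y∈S → [ (λ x≡y → inj₂ (trans (sym x≡) x≡y)) , (λ x′≡y → inj₁ (trans (⁻¹-involutive x′) x′≡y)) ]′ (S⊆ y∈S))
  (subst S (sym (⁻¹-involutive x′)) x′∈S) (subst S x≡ x∈S)

∈-±-pair-cancelʳ : b ≢ 0ℚ → x * b ≡ w → y * b ≡ w′ → w′ ∈ ±-pair w → y ∈ ±-pair x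
∈-±-pair-cancelʳ {b} {x} b≢0 xb≡w yb≡w′ (inj₁ -w≡w′) =
  inj₁ (*-cancelʳ-≡ b b≢0 (trans (sym (neg-distribˡ-* x b)) (trans (cong -_ xb≡w) (trans -w≡w′ (sym yb≡w′)))))
∈-±-pair-cancelʳ b≢0 xb≡w yb≡w′ (inj₂ w≡w′) = inj₂ (*-cancelʳ-≡ _ b≢0 (trans xb≡w (trans w≡w′ (sym yb≡w′))))

-- Products of sets, scaling, and finite arithmetic progressions

·ˢ-comm : (A ·ˢ B) ≐ (B ·ˢ A)
·ˢ-comm = swap , swap
  where
  swap : ∀ {A B} → A ·ˢ B ⊆ B ·ˢ A
  swap (y , c , y∈A , c∈B , eq) = c , y , c∈B , y∈A , trans eq (*-comm y c)

∖-congˡ : A ≐ B → (A ∖ S) ≐ (B ∖ S)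
∖-congˡ (A⊆B , B⊆A) = (λ (a , a∉S) → A⊆B a , a∉S) , (λ (b , b∉S) → B⊆A b , b∉S)

_⊙_ : ℚ → Pred ℚ 0ℓ → Pred ℚ 0ℓ
(μ ⊙ S) y = ∃[ s ] (s ∈ S × y ≡ μ * s)

⊙-congʳ : A ≐ B → μ ⊙ A ≐ μ ⊙ B
⊙-congʳ (A⊆B , B⊆A) = (λ (s , s∈A , eq) → s , A⊆B s∈A , eq) , (λ (s , s∈B , eq) → s , B⊆A s∈B , eq)

⊙-·ˢ : ((μ ⊙ A) ·ˢ B) ≐ μ ⊙ (A ·ˢ B)
⊙-·ˢ {μ} = to , from
  where
  to : ∀ {A B} → (μ ⊙ A) ·ˢ B ⊆ μ ⊙ (A ·ˢ B)
  to (_ , c , (s , s∈A , refl) , c∈B , refl) = s * c , (s , c , s∈A , c∈B , refl) , *-assoc μ s c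
  from : ∀ {A B} → μ ⊙ (A ·ˢ B) ⊆ (μ ⊙ A) ·ˢ B
  from (_ , (s , c , s∈A , c∈B , refl) , refl) = μ * s , c , (s , s∈A , refl) , c∈B , sym (*-assoc μ s c)

⊙-∖-0 : μ ≢ 0ℚ → μ ⊙ (S ∖ ｛ 0ℚ ｝) ≐ (μ ⊙ S) ∖ ｛ 0ℚ ｝
⊙-∖-0 {μ} μ≢0 = to , from
  where
  to : ∀ {S} → μ ⊙ (S ∖ ｛ 0ℚ ｝) ⊆ (μ ⊙ S) ∖ ｛ 0ℚ ｝
  to (s , (s∈S , s≢0) , refl) = (s , s∈S , refl) ,
    λ 0≡μs → s≢0 (sym (*-cancelˡ-≡ μ μ≢0 (trans (sym 0≡μs) (sym (*-zeroʳ μ)))))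
  from : ∀ {S} → (μ ⊙ S) ∖ ｛ 0ℚ ｝ ⊆ μ ⊙ (S ∖ ｛ 0ℚ ｝)
  from ((s , s∈S , refl) , μs≢0) = s , (s∈S , λ 0≡s → μs≢0 (sym (trans (cong (μ *_) (sym 0≡s)) (*-zeroʳ μ)))) , refl

⊙-inverse : ∀ μ .{{_ : NonZero μ}} → S ≐ (1/ μ) ⊙ (μ ⊙ S)
⊙-inverse {S} μ = (λ {s} s∈S → μ * s , (s , s∈S , refl) , sym (cancel s)) , λ { (_ , (s , s∈S , refl) , refl) → subst S (sym (cancel s)) s∈S }
  where
  cancel : ∀ s → 1/ μ * (μ * s) ≡ s
  cancel s = trans (sym (*-assoc (1/ μ) μ s)) (trans (cong (_* s) (*-inverseˡ μ)) (*-identityˡ s))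

⊙-pair : μ ⊙ (｛ s ｝ ∪ ｛ t ｝) ≐ ｛ μ * s ｝ ∪ ｛ μ * t ｝
⊙-pair {μ} {s} {t} = (λ { (_ , inj₁ refl , refl) → inj₁ refl ; (_ , inj₂ refl , refl) → inj₂ refl })
                   , (λ { (inj₁ refl) → s , inj₁ refl , refl ; (inj₂ refl) → t , inj₂ refl , refl })

⊙-±-pair : μ ⊙ ±-pair r ≐ ±-pair (μ * r)
⊙-±-pair {μ} {r} = subst (λ z → μ ⊙ ±-pair r ≐ ｛ z ｝ ∪ ｛ μ * r ｝) (sym (neg-distribʳ-* μ r)) (⊙-pair {μ} { - r} {r})

⊙-doubling-pair : μ ⊙ doubling-pair r ≐ doubling-pair (μ * r)
⊙-doubling-pair {μ} {r} = subst₂ (λ z z′ → μ ⊙ doubling-pair r ≐ ｛ z ｝ ∪ ｛ z′ ｝)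
  (sym (neg-distribʳ-* μ r))
  (solve 2 (λ μ r → μ :* ((con 1ℚ :+ con 1ℚ) :* r) := (con 1ℚ :+ con 1ℚ) :* (μ :* r)) refl μ r)
  (⊙-pair {μ} { - r} {(1ℚ + 1ℚ) * r})

⊙-AtLeastTwo : μ ≢ 0ℚ → AtLeastTwo S → AtLeastTwo (μ ⊙ S)
⊙-AtLeastTwo {μ} μ≢0 (y , y′ , y∈S , y′∈S , y≢y′) =
  μ * y , μ * y′ , (y , y∈S , refl) , (y′ , y′∈S , refl) , λ eq → y≢y′ (*-cancelˡ-≡ μ μ≢0 eq)

Conclusion-⊙ : μ ≢ 0ℚ → Conclusion (μ ⊙ A) B → Conclusion A B
Conclusion-⊙ {μ} {A} μ≢0 (r , r₁ , r₂ , inj₁ (A≐ , B≐)) =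
  conclusion-doubling (≐-trans (≐-trans (⊙-inverse {A} μ) (⊙-congʳ {μ = 1/ μ} A≐)) (⊙-doubling-pair {1/ μ} {r₁})) B≐
  where instance _ = ≢-nonZero μ≢0
Conclusion-⊙ {μ} {A} μ≢0 (r , r₁ , r₂ , inj₂ (inj₁ A≐)) =
  conclusion-±ˡ (≐-trans (≐-trans (⊙-inverse {A} μ) (⊙-congʳ {μ = 1/ μ} A≐)) (⊙-±-pair {1/ μ} {r}))
  where instance _ = ≢-nonZero μ≢0
Conclusion-⊙ μ≢0 (r , r₁ , r₂ , inj₂ (inj₂ B≐)) = conclusion-±ʳ B≐

⊙-AP : μ ⊙ AP a d n ≐ AP (μ * a) (μ * d) n
⊙-AP {μ} {a} {d} = (λ { (_ , (k , k<n , refl) , refl) → k , k<n , distrib k })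
                 , (λ { (k , k<n , refl) → a + ℕ→ℚ k * d , (k , k<n , refl) , sym (distrib k) })
  where
  distrib : ∀ k → μ * (a + ℕ→ℚ k * d) ≡ μ * a + ℕ→ℚ k * (μ * d)
  distrib k = solve 4 (λ μ a K d → μ :* (a :+ K :* d) := μ :* a :+ K :* (μ :* d)) refl μ a (ℕ→ℚ k) d

AP-reverse-⊆ : AP a d (suc m) ⊆ AP (a + ℕ→ℚ m * d) (- d) (suc m)
AP-reverse-⊆ {a} {d} {m} (k , s≤s k≤m , refl) = m ℕ.∸ k , s≤s (ℕ.m∸n≤m m k) , (begin
  a + ℕ→ℚ k * d                                            ≡⟨ solve 4 (λ a d K L → a :+ K :* d := (a :+ (K :+ L) :* d) :+ L :* (:- d)) refl a d (ℕ→ℚ k) (ℕ→ℚ (m ℕ.∸ k)) ⟩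
  (a + (ℕ→ℚ k + ℕ→ℚ (m ℕ.∸ k)) * d) + ℕ→ℚ (m ℕ.∸ k) * - d  ≡⟨ cong (λ z → (a + z * d) + ℕ→ℚ (m ℕ.∸ k) * - d) (trans (sym (ℕ→ℚ-homo-+ k (m ℕ.∸ k))) (cong ℕ→ℚ (ℕ.m+[n∸m]≡n k≤m))) ⟩
  (a + ℕ→ℚ m * d) + ℕ→ℚ (m ℕ.∸ k) * - d                    ∎)
  where open ≡-Reasoning

AP-reverse : AP a d (suc m) ≐ AP (a + ℕ→ℚ m * d) (- d) (suc m)
AP-reverse {a} {d} {m} = AP-reverse-⊆ {a} {d} {m} , λ {y} y∈ → subst₂ (λ a′ d′ → y ∈ AP a′ d′ (suc m))
  (solve 3 (λ a d M → (a :+ M :* d) :+ M :* (:- d) := a) refl a d (ℕ→ℚ m)) (⁻¹-involutive d) (AP-reverse-⊆ {a + ℕ→ℚ m * d} { - d} {m} y∈)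

*≡-1⇒≢0 : μ * d ≡ - 1ℚ → μ ≢ 0ℚ
*≡-1⇒≢0 {μ} {d} μd≡-1 refl = 0≢-1 (trans (sym (*-zeroˡ d)) μd≡-1)
  where
  0≢-1 : 0ℚ ≢ - 1ℚ
  0≢-1 ()

AP-rescale : μ * d ≡ - 1ℚ → (AP a d n ∖ ｛ 0ℚ ｝) ≐ (A ·ˢ B) → (AP (μ * a) (- 1ℚ) n ∖ ｛ 0ℚ ｝) ≐ ((μ ⊙ A) ·ˢ B)
AP-rescale {μ} {d} {a} {n} {A} {B} μd≡-1 factors =
  ≐-trans (∖-congˡ (≐-sym (subst (λ e → μ ⊙ AP a d n ≐ AP (μ * a) e n) μd≡-1 (⊙-AP {μ} {a} {d} {n}))))
  (≐-trans (≐-sym (⊙-∖-0 {μ = μ} {S = AP a d n} (*≡-1⇒≢0 μd≡-1)))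
  (≐-trans (⊙-congʳ {μ = μ} factors) (≐-sym (⊙-·ˢ {μ = μ} {A = A} {B = B}))))

AP-difference-nonzero : (AP a d n ∖ ｛ 0ℚ ｝) ≐ (A ·ˢ B) → AtLeastTwo A → c ∈ B → d ≢ 0ℚ
AP-difference-nonzero {a = a} {A = A} {c = c} factors (y , y′ , y∈A , y′∈A , y≢y′) c∈B refl =
  y≢y′ (*-cancelʳ-≡ c c≢0 (trans (value y∈A) (sym (value y′∈A))))
  where
  value : ∀ {z} → z ∈ A → z * c ≡ a
  value z∈A with proj₂ factors (_ , c , z∈A , c∈B , refl)
  ... | (k , _ , eq) , _ = trans eq (trans (cong (a +_) (*-zeroʳ (ℕ→ℚ k))) (+-identityʳ a))
  c≢0 : c ≢ 0ℚ
  c≢0 c≡0 = proj₂ (proj₂ factors (y , c , y∈A , c∈B , refl)) (sym (trans (cong (y *_) c≡0) (*-zeroʳ y)))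

normalise : AtLeastTwo A → AtLeastTwo B → (AP a d n ∖ ｛ 0ℚ ｝) ≐ (A ·ˢ B) →
  ∃[ μ ] ∃[ u ] ∃[ m ] (μ ≢ 0ℚ × ℕ→ℚ m ≤ u + u × (AP u (- 1ℚ) (suc m) ∖ ｛ 0ℚ ｝) ≐ ((μ ⊙ A) ·ˢ B))
normalise {n = zero} (y , _ , y∈A , _) (c , _ , c∈B , _) factors with proj₁ (proj₂ factors (y , c , y∈A , c∈B , refl))
... | _ , () , _
normalise {A = A} {B = B} {a = a} {d = d} {n = suc m} twoA (c , _ , c∈B , _) factors = centre (ℕ→ℚ m ≤? u₀ + u₀)
  where
  instance _ = ≢-nonZero (AP-difference-nonzero {a = a} {d = d} {n = suc m} factors twoA c∈B)
  u₀ : ℚ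
  u₀ = - (1/ d) * a
  centre : Dec (ℕ→ℚ m ≤ u₀ + u₀) →
    ∃[ μ ] ∃[ u ] ∃[ m′ ] (μ ≢ 0ℚ × ℕ→ℚ m′ ≤ u + u × (AP u (- 1ℚ) (suc m′) ∖ ｛ 0ℚ ｝) ≐ ((μ ⊙ A) ·ˢ B))
  centre (yes m≤2u₀) = - (1/ d) , u₀ , m , *≡-1⇒≢0 μd≡-1 , m≤2u₀ , AP-rescale {μ = - (1/ d)} {d = d} {a = a} μd≡-1 factors
    where
    μd≡-1 : - (1/ d) * d ≡ - 1ℚ
    μd≡-1 = trans (sym (neg-distribˡ-* (1/ d) d)) (cong -_ (*-inverseˡ d))
  centre (no m≰2u₀) = 1/ d , u₁ , m , *≡-1⇒≢0 μd≡-1 , m≤2u₁ ,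
    AP-rescale {μ = 1/ d} {d = - d} {a = a + ℕ→ℚ m * d} μd≡-1 (≐-trans (∖-congˡ (≐-sym (AP-reverse {a = a} {d = d} {m = m}))) factors)
    where
    u₁ : ℚ
    u₁ = (1/ d) * (a + ℕ→ℚ m * d)
    μd≡-1 : (1/ d) * - d ≡ - 1ℚ
    μd≡-1 = trans (sym (neg-distribʳ-* (1/ d) d)) (cong -_ (*-inverseˡ d))
    m≤2u₁ : ℕ→ℚ m ≤ u₁ + u₁
    m≤2u₁ = begin
      ℕ→ℚ m                           ≡⟨ sym (+-identityʳ (ℕ→ℚ m)) ⟩
      ℕ→ℚ m + 0ℚ                      ≤⟨ +-monoʳ-≤ (ℕ→ℚ m) (p≤q⇒0≤q-p (<⇒≤ (≰⇒> m≰2u₀))) ⟩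
      ℕ→ℚ m + (ℕ→ℚ m - (u₀ + u₀))     ≡⟨ ≡-by-difference (ℕ→ℚ m + ℕ→ℚ m)
                                           (solve 4 (λ M t a d → (M :+ (M :- ((:- t) :* a :+ (:- t) :* a))) :- (t :* (a :+ M :* d) :+ t :* (a :+ M :* d))
                                              := (M :+ M) :* (con 1ℚ :- t :* d)) refl (ℕ→ℚ m) (1/ d) a d)
                                           (sym (*-inverseˡ d)) ⟩
      u₁ + u₁                         ∎
      where open ≤-Reasoning

-- Factorisations of the progression u, u - 1, …, u - m

module Indexing {A B : Pred ℚ 0ℓ} {u : ℚ} {m : ℕ}
  (bound : ℕ→ℚ m ≤ u + u)
  (factors : (AP u (- 1ℚ) (suc m) ∖ ｛ 0ℚ ｝) ≐ (A ·ˢ B))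
  where

  v : ℕ → ℚ
  v k = u - ℕ→ℚ k

  NonzeroTerm : ℚ → Set
  NonzeroTerm p = ∃[ k ] (k ℕ.≤ m × v k ≢ 0ℚ × p ≡ v k)

  AP-term : ∀ k → u + ℕ→ℚ k * - 1ℚ ≡ v k
  AP-term k = solve 2 (λ u K → u :+ K :* (:- con 1ℚ) := u :- K) refl u (ℕ→ℚ k)

  product-index : y ∈ A → c ∈ B → NonzeroTerm (y * c)
  product-index {y = y} {c = c} y∈A c∈B = index (proj₂ factors (y , c , y∈A , c∈B , refl))
    where
    index : (AP u (- 1ℚ) (suc m) ∖ ｛ 0ℚ ｝) (y * c) → NonzeroTerm (y * c)
    index ((k , s≤s k≤m , yc≡) , yc≢0) =
      k , k≤m , (λ vk≡0 → yc≢0 (sym (trans (trans yc≡ (AP-term k)) vk≡0))) , trans yc≡ (AP-term k)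

  factor-nonzeroʳ : y ∈ A → c ∈ B → c ≢ 0ℚ
  factor-nonzeroʳ {y = y} {c = c} y∈A c∈B c≡0 =
    let _ , _ , vk≢0 , yc≡vk = product-index y∈A c∈B
    in vk≢0 (trans (sym yc≡vk) (trans (cong (y *_) c≡0) (*-zeroʳ y)))

  factor-nonzeroˡ : y ∈ A → c ∈ B → y ≢ 0ℚ
  factor-nonzeroˡ {y = y} {c = c} y∈A c∈B y≡0 =
    let _ , _ , vk≢0 , yc≡vk = product-index y∈A c∈B
    in vk≢0 (trans (sym yc≡vk) (trans (cong (_* c) y≡0) (*-zeroˡ c)))

  factorisation : k ℕ.≤ m → v k ≢ 0ℚ → ∃[ y ] ∃[ c ] (y ∈ A × c ∈ B × y * c ≡ v k)
  factorisation {k = k} k≤m vk≢0 =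
    rearrange (proj₁ factors {u + ℕ→ℚ k * - 1ℚ} ((k , s≤s k≤m , refl) , λ 0≡ → vk≢0 (trans (sym (AP-term k)) (sym 0≡))))
    where
    rearrange : (A ·ˢ B) (u + ℕ→ℚ k * - 1ℚ) → ∃[ y ] ∃[ c ] (y ∈ A × c ∈ B × y * c ≡ v k)
    rearrange (y , c , y∈A , c∈B , eq) = y , c , y∈A , c∈B , trans (sym eq) (AP-term k)

  index-bound : k ℕ.≤ m → ℕ→ℚ k ≤ u + u
  index-bound k≤m = ≤-trans (ℕ→ℚ-mono-≤ k≤m) bound

  v-injective : v i ≡ v j → i ≡ j
  v-injective {i = i} {j = j} eq = ℕ→ℚ-injective (≡-by-difference (- 1ℚ)
    (solve 3 (λ u I J → I :- J := con (- 1ℚ) :* ((u :- I) :- (u :- J))) refl u (ℕ→ℚ i) (ℕ→ℚ j)) eq)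

  -- The expansion of (yc)(y′c′) = (yc′)(y′c), where y′c is the top term v 0 = u.
  rectangle : ∀ y c y′ c′ → y * c ≡ v i → y′ * c′ ≡ v j → y * c′ ≡ v k → y′ * c ≡ v 0 →
              ℕ→ℚ i * ℕ→ℚ j + ℕ→ℚ k * u ≡ (ℕ→ℚ i + ℕ→ℚ j) * u
  rectangle {i = i} {j = j} {k = k} y c y′ c′ yc y′c′ yc′ y′c = ≡-by-difference 1ℚ
    (solve 4 (λ u I J K → (I :* J :+ K :* u) :- (I :+ J) :* u := con 1ℚ :* ((u :- I) :* (u :- J) :- (u :- K) :* (u :- con 0ℚ)))
      refl u (ℕ→ℚ i) (ℕ→ℚ j) (ℕ→ℚ k))
    (begin
      v i * v j            ≡⟨ cong₂ _*_ (sym yc) (sym y′c′) ⟩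
      (y * c) * (y′ * c′)  ≡⟨ solve 4 (λ y c y′ c′ → (y :* c) :* (y′ :* c′) := (y :* c′) :* (y′ :* c)) refl y c y′ c′ ⟩
      (y * c′) * (y′ * c)  ≡⟨ cong₂ _*_ yc′ y′c ⟩
      v k * v 0            ∎)
    where open ≡-Reasoning

  u-positive : y ∈ A → c ∈ B → 0ℚ < u
  u-positive y∈A c∈B = by-sign (product-index y∈A c∈B) (<-cmp 0ℚ u)
    where
    by-sign : NonzeroTerm _ → Tri (0ℚ < u) (0ℚ ≡ u) (u < 0ℚ) → 0ℚ < u
    by-sign _ (tri< 0<u _ _) = 0<u
    by-sign (k , k≤m , vk≢0 , _) (tri≈ _ 0≡u _) = ⊥-elim (vk≢0 (trans (cong (_- ℕ→ℚ k) (sym 0≡u)) (cong (λ z → 0ℚ - z) k≡0)))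
      where
      k≡0 : ℕ→ℚ k ≡ 0ℚ
      k≡0 = ≤-antisym (subst (λ z → ℕ→ℚ k ≤ z + z) (sym 0≡u) (index-bound k≤m)) (ℕ→ℚ-nonNeg k)
    by-sign (k , k≤m , _ , _) (tri> _ _ u<0) =
      ⊥-elim (<-irrefl refl (≤-<-trans (≤-trans (ℕ→ℚ-nonNeg k) (index-bound k≤m)) (+-mono-< u<0 u<0)))

  1≤m : AtLeastTwo A → c ∈ B → 1 ℕ.≤ m
  1≤m {c = c} (y₁ , y₂ , y₁∈A , y₂∈A , y₁≢y₂) c∈B = ℕ.n≢0⇒n>0 λ m≡0 →
    let k₁ , k₁≤m , _ , y₁c = product-index y₁∈A c∈B
        k₂ , k₂≤m , _ , y₂c = product-index y₂∈A c∈B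
    in y₁≢y₂ (*-cancelʳ-≡ c (factor-nonzeroʳ y₁∈A c∈B)
         (trans y₁c (trans (cong v (trans (top k₁≤m m≡0) (sym (top k₂≤m m≡0)))) (sym y₂c))))
    where
    top : k ℕ.≤ m → m ≡ 0 → k ≡ 0
    top {k = k} k≤m m≡0 = ℕ.n≤0⇒n≡0 (subst (k ℕ.≤_) m≡0 k≤m)

module Core {A B : Pred ℚ 0ℓ} {u : ℚ} {m : ℕ}
  (bound : ℕ→ℚ m ≤ u + u)
  (factors : (AP u (- 1ℚ) (suc m) ∖ ｛ 0ℚ ｝) ≐ (A ·ˢ B))
  (0<u : 0ℚ < u)
  where

  open Indexing {A} {B} {u} {m} bound factors public

  -- k = e u ≤ 2u leaves e ∈ {0, 1, 2}, and e = 1 would make v k vanish.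
  multiple-of-u : k ℕ.≤ m → v k ≢ 0ℚ → ∃[ e ] ℕ→ℚ k ≡ ℕ→ℚ e * u → v k ∈ ±-pair (v 0)
  multiple-of-u {k = k} k≤m vk≢0 (e , k≡eu) = small e (ℕ→ℚ-cancel-≤ {m = e} {n = 2} (*-cancelʳ-≤-pos u eu≤2u)) k≡eu
    where
    instance _ = positive 0<u
    eu≤2u : ℕ→ℚ e * u ≤ ℕ→ℚ 2 * u
    eu≤2u = begin
      ℕ→ℚ e * u  ≡⟨ sym k≡eu ⟩
      ℕ→ℚ k      ≤⟨ index-bound k≤m ⟩
      u + u      ≡⟨ solve 1 (λ u → u :+ u := con (ℕ→ℚ 2) :* u) refl u ⟩
      ℕ→ℚ 2 * u  ∎
      where open ≤-Reasoning
    small : ∀ e → e ℕ.≤ 2 → ℕ→ℚ k ≡ ℕ→ℚ e * u → v k ∈ ±-pair (v 0)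
    small 0 _ eq = inj₂ (cong (λ z → u - z) (sym (trans eq (*-zeroˡ u))))
    small 1 _ eq = ⊥-elim (vk≢0 (trans (cong (λ z → u - z) (trans eq (*-identityˡ u))) (+-inverseʳ u)))
    small 2 _ eq = inj₁ (trans (solve 1 (λ u → :- (u :- con 0ℚ) := u :- con (ℕ→ℚ 2) :* u) refl u) (cong (λ z → u - z) (sym eq)))
    small (suc (suc (suc _))) (s≤s (s≤s ()))

  degenerate : b ∈ B → x * b ≡ v 0 → v 1 ≡ 0ℚ → ∀ {y} → y ∈ A → y ∈ ±-pair x
  degenerate {b = b} {x = x} b∈B xb v1≡0 {y} y∈A = at (product-index y∈A b∈B)
    where
    at : NonzeroTerm (y * b) → y ∈ ±-pair x
    at (k , k≤m , vk≢0 , yb) = ∈-±-pair-cancelʳ (factor-nonzeroʳ y∈A b∈B) xb yb (multiple-of-u k≤m vk≢0 (k , k≡ku))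
      where
      k≡ku : ℕ→ℚ k ≡ ℕ→ℚ k * u
      k≡ku = trans (sym (*-identityʳ (ℕ→ℚ k))) (cong (ℕ→ℚ k *_) (sym (x∙y⁻¹≈ε⇒x≈y u 1ℚ v1≡0)))

  shared : b ∈ B → b′ ∈ B → x * b ≡ v 0 → x * b′ ≡ v 1 → ∀ {y} → y ∈ A → y ∈ ±-pair x
  shared {b = b} {b′ = b′} {x = x} b∈B b′∈B xb xb′ {y} y∈A = at (product-index y∈A b∈B) (product-index y∈A b′∈B)
    where
    at : NonzeroTerm (y * b) → NonzeroTerm (y * b′) → y ∈ ±-pair x
    at (i , i≤m , vi≢0 , yb) (j , _ , _ , yb′) =
      ∈-±-pair-cancelʳ (factor-nonzeroʳ y∈A b∈B) xb yb (multiple-of-u i≤m vi≢0 (ℕ→ℚ-multiple i (suc i) j (<⇒≤ 0<u) relation))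
      where
      relation : ℕ→ℚ i + ℕ→ℚ j * u ≡ ℕ→ℚ (suc i) * u
      relation = begin
        ℕ→ℚ i + ℕ→ℚ j * u       ≡⟨ cong (_+ ℕ→ℚ j * u) (sym (*-identityʳ (ℕ→ℚ i))) ⟩
        ℕ→ℚ i * 1ℚ + ℕ→ℚ j * u  ≡⟨ rectangle {i = i} {j = 1} {k = j} y b x b′ yb xb′ yb′ xb ⟩
        (ℕ→ℚ i + 1ℚ) * u        ≡⟨ cong (_* u) (trans (+-comm (ℕ→ℚ i) 1ℚ) (sym (ℕ→ℚ-suc i))) ⟩
        ℕ→ℚ (suc i) * u         ∎
        where open ≡-Reasoning

  -- The expansion of v i * v j ≡ v 0 * v 1.
  Complementary : ℕ → ℕ → Set
  Complementary i j = ℕ→ℚ i * ℕ→ℚ j + ℕ→ℚ 1 * u ≡ (ℕ→ℚ i + ℕ→ℚ j) * u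

  Complementary-sym : Complementary i j → Complementary j i
  Complementary-sym {i = i} {j = j} rel =
    trans (cong (_+ ℕ→ℚ 1 * u) (*-comm (ℕ→ℚ j) (ℕ→ℚ i))) (trans rel (cong (_* u) (+-comm (ℕ→ℚ i) (ℕ→ℚ j))))

  complementary : x * b ≡ v 0 → x′ * b′ ≡ v 1 → x * b′ ≡ v i → x′ * b ≡ v j → Complementary i j
  complementary {x = x} {b = b} {x′ = x′} {b′ = b′} {i = i} {j = j} xb x′b′ xb′ x′b =
    Complementary-sym {i = j} {j = i} (rectangle {i = j} {j = i} {k = 1} x′ b x b′ x′b xb′ x′b′ xb)

  complementary-one : Complementary 1 j → j ≢ 0 → v 1 ≡ 0ℚ
  complementary-one {j = j} rel j≢0 = x≈y⇒x∙y⁻¹≈ε (*-cancelˡ-≡ (ℕ→ℚ j) (ℕ→ℚ-≢0 j≢0) (≡-by-difference (- 1ℚ)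
    (solve 2 (λ J u → J :* u :- J :* con 1ℚ := con (- 1ℚ) :* ((con 1ℚ :* J :+ con 1ℚ :* u) :- (con 1ℚ :+ J) :* u)) refl (ℕ→ℚ j) u)
    rel))

  complementary-bound : i ℕ.≤ m → Complementary i j → i ℕ.≤ suc j
  complementary-bound {i = i} {j = j} i≤m rel =
    ℕ.+-cancelʳ-≤ j i (suc j) (ℕ→ℚ-cancel-≤ {m = i ℕ.+ j} {n = suc j ℕ.+ j} (*-cancelʳ-≤-pos u chain))
    where
    instance _ = positive 0<u
    chain : ℕ→ℚ (i ℕ.+ j) * u ≤ ℕ→ℚ (suc j ℕ.+ j) * u
    chain = begin
      ℕ→ℚ (i ℕ.+ j) * u            ≡⟨ cong (_* u) (ℕ→ℚ-homo-+ i j) ⟩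
      (ℕ→ℚ i + ℕ→ℚ j) * u          ≡⟨ sym rel ⟩
      ℕ→ℚ i * ℕ→ℚ j + ℕ→ℚ 1 * u    ≤⟨ +-monoˡ-≤ (ℕ→ℚ 1 * u) (*-monoʳ-≤-nonNeg (ℕ→ℚ j) {{nonNegative (ℕ→ℚ-nonNeg j)}} (index-bound i≤m)) ⟩
      (u + u) * ℕ→ℚ j + ℕ→ℚ 1 * u  ≡⟨ solve 2 (λ J u → (u :+ u) :* J :+ con 1ℚ :* u := (con 1ℚ :+ J :+ J) :* u) refl (ℕ→ℚ j) u ⟩
      (1ℚ + ℕ→ℚ j + ℕ→ℚ j) * u     ≡⟨ cong (_* u) (sym (trans (ℕ→ℚ-homo-+ (suc j) j) (cong (_+ ℕ→ℚ j) (ℕ→ℚ-suc j)))) ⟩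
      ℕ→ℚ (suc j ℕ.+ j) * u        ∎
      where open ≤-Reasoning

  -- Here 1 + i = 2u, and every y ∈ A with y b = v k and y b′ = v l satisfies k = (k + l - i) u.
  successive : b ∈ B → b′ ∈ B → x * b ≡ v 0 → x * b′ ≡ v i → i ≢ 0 → Complementary i (suc i) →
               ∀ {y} → y ∈ A → y ∈ ±-pair x
  successive {b = b} {b′ = b′} {x = x} {i = i} b∈B b′∈B xb xb′ i≢0 rel {y} y∈A =
    at (product-index y∈A b∈B) (product-index y∈A b′∈B)
    where
    1+i≡2u : 1ℚ + ℕ→ℚ i ≡ u + u
    1+i≡2u = *-cancelˡ-≡ (ℕ→ℚ i) (ℕ→ℚ-≢0 i≢0) (≡-by-difference 1ℚ
      (solve 2 (λ I u → I :* (con 1ℚ :+ I) :- I :* (u :+ u) := con 1ℚ :* ((I :* (con 1ℚ :+ I) :+ con 1ℚ :* u) :- (I :+ (con 1ℚ :+ I)) :* u))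
        refl (ℕ→ℚ i) u)
      (subst (λ z → ℕ→ℚ i * z + ℕ→ℚ 1 * u ≡ (ℕ→ℚ i + z) * u) (ℕ→ℚ-suc i) rel))
    at : NonzeroTerm (y * b) → NonzeroTerm (y * b′) → y ∈ ±-pair x
    at (k , k≤m , vk≢0 , yb) (l , _ , _ , yb′) =
      ∈-±-pair-cancelʳ (factor-nonzeroʳ y∈A b∈B) xb yb (multiple-of-u k≤m vk≢0 (ℕ→ℚ-multiple k (k ℕ.+ l) i (<⇒≤ 0<u) relation))
      where
      relation : ℕ→ℚ k + ℕ→ℚ i * u ≡ ℕ→ℚ (k ℕ.+ l) * u
      relation = trans (≡-by-difference₂ (- 1ℚ) (ℕ→ℚ k)
        (solve 4 (λ K L I u → (K :+ I :* u) :- (K :+ L) :* u := con (- 1ℚ) :* ((K :* I :+ L :* u) :- (K :+ I) :* u) :+ K :* ((con 1ℚ :+ I) :- (u :+ u)))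
          refl (ℕ→ℚ k) (ℕ→ℚ l) (ℕ→ℚ i) u)
        (rectangle {i = k} {j = i} {k = l} y b x b′ yb xb′ yb′ xb) 1+i≡2u) (cong (_* u) (sym (ℕ→ℚ-homo-+ k l)))

  -- (2i - 1) k ≤ 2 i², read off from k ≤ 2u and (2i - 1) u = i².
  equal-index-bound : k ℕ.≤ m → Complementary i i → i ℕ.* k ℕ.+ i ℕ.* k ℕ.≤ i ℕ.* i ℕ.+ i ℕ.* i ℕ.+ k
  equal-index-bound {k = k} {i = i} k≤m rel =
    ℕ→ℚ-cancel-≤ {m = i ℕ.* k ℕ.+ i ℕ.* k} {n = i ℕ.* i ℕ.+ i ℕ.* i ℕ.+ k} (*-cancelʳ-≤-pos u chain)
    where
    instance _ = positive 0<u
    I K : ℚ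
    I = ℕ→ℚ i
    K = ℕ→ℚ k
    ii≡I*I : ℕ→ℚ (i ℕ.* i) ≡ I * I
    ii≡I*I = ℕ→ℚ-homo-* i i
    chain : ℕ→ℚ (i ℕ.* k ℕ.+ i ℕ.* k) * u ≤ ℕ→ℚ (i ℕ.* i ℕ.+ i ℕ.* i ℕ.+ k) * u
    chain = begin
      ℕ→ℚ (i ℕ.* k ℕ.+ i ℕ.* k) * u        ≡⟨ cong (_* u) (trans (ℕ→ℚ-homo-+ (i ℕ.* k) (i ℕ.* k)) (cong₂ _+_ (ℕ→ℚ-homo-* i k) (ℕ→ℚ-homo-* i k))) ⟩
      (I * K + I * K) * u                  ≡⟨ solve 3 (λ I K u → (I :* K :+ I :* K) :* u := K :* ((I :+ I) :* u)) refl I K u ⟩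
      K * ((I + I) * u)                    ≡⟨ cong (K *_) (sym rel) ⟩
      K * (I * I + ℕ→ℚ 1 * u)              ≡⟨ solve 3 (λ I K u → K :* (I :* I :+ con 1ℚ :* u) := K :* (I :* I) :+ K :* u) refl I K u ⟩
      K * (I * I) + K * u                  ≤⟨ +-monoˡ-≤ (K * u) (*-monoʳ-≤-nonNeg (I * I)
                                                {{nonNegative (subst (0ℚ ≤_) ii≡I*I (ℕ→ℚ-nonNeg (i ℕ.* i)))}} (index-bound k≤m)) ⟩
      (u + u) * (I * I) + K * u            ≡⟨ solve 3 (λ I K u → (u :+ u) :* (I :* I) :+ K :* u := (I :* I :+ I :* I :+ K) :* u) refl I K u ⟩
      (I * I + I * I + K) * u              ≡⟨ cong (λ z → (z + z + K) * u) (sym ii≡I*I) ⟩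
      (ℕ→ℚ (i ℕ.* i) + ℕ→ℚ (i ℕ.* i) + K) * u
        ≡⟨ cong (_* u) (sym (trans (ℕ→ℚ-homo-+ (i ℕ.* i ℕ.+ i ℕ.* i) k) (cong (_+ K) (ℕ→ℚ-homo-+ (i ℕ.* i) (i ℕ.* i))))) ⟩
      ℕ→ℚ (i ℕ.* i ℕ.+ i ℕ.* i ℕ.+ k) * u  ∎
      where open ≤-Reasoning

  -- Every y ∈ A with y b = v k and y b′ = v l has k = (k + l - i) i, and the bound above
  -- leaves only k = 0 and k = i.
  equal : b ∈ B → b′ ∈ B → x * b ≡ v 0 → x * b′ ≡ v i → x′ * b ≡ v i → 2 ℕ.≤ i → Complementary i i →
          ∀ {y} → y ∈ A → y ∈ ｛ x ｝ ∪ ｛ x′ ｝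
  equal {b = b} {b′ = b′} {x = x} {i = i} {x′ = x′} b∈B b′∈B xb xb′ x′b 2≤i rel {y} y∈A =
    at (product-index y∈A b∈B) (product-index y∈A b′∈B)
    where
    b≢0 : b ≢ 0ℚ
    b≢0 = factor-nonzeroʳ y∈A b∈B
    at : NonzeroTerm (y * b) → NonzeroTerm (y * b′) → y ∈ ｛ x ｝ ∪ ｛ x′ ｝
    at (k , k≤m , _ , yb) (l , _ , _ , yb′) = by-multiple (ℕ→ℚ-multiple k (k ℕ.+ l) i (ℕ→ℚ-nonNeg i) relation)
      where
      relation : ℕ→ℚ k + ℕ→ℚ i * ℕ→ℚ i ≡ ℕ→ℚ (k ℕ.+ l) * ℕ→ℚ i
      relation = trans (*-cancelˡ-≡ u (λ u≡0 → <-irrefl (sym u≡0) 0<u) (≡-by-difference₂ (- ℕ→ℚ i) (ℕ→ℚ k)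
        (solve 4 (λ K L I u → u :* (K :+ I :* I) :- u :* ((K :+ L) :* I)
                    := (:- I) :* ((K :* I :+ L :* u) :- (K :+ I) :* u) :+ K :* ((I :* I :+ con 1ℚ :* u) :- (I :+ I) :* u))
          refl (ℕ→ℚ k) (ℕ→ℚ l) (ℕ→ℚ i) u)
        (rectangle {i = k} {j = i} {k = l} y b x b′ yb xb′ yb′ xb) rel)) (cong (_* ℕ→ℚ i) (sym (ℕ→ℚ-homo-+ k l)))
      by-index : ∀ e → e ℕ.≤ 1 → k ≡ e ℕ.* i → y ∈ ｛ x ｝ ∪ ｛ x′ ｝
      by-index 0 _ k≡0 = inj₁ (*-cancelʳ-≡ b b≢0 (trans xb (trans (cong v (sym k≡0)) (sym yb))))
      by-index 1 _ k≡i = inj₂ (*-cancelʳ-≡ b b≢0 (trans x′b (trans (cong v (sym (trans k≡i (ℕ.+-identityʳ i)))) (sym yb))))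
      by-index (suc (suc _)) (s≤s ()) _
      by-multiple : ∃[ e ] ℕ→ℚ k ≡ ℕ→ℚ e * ℕ→ℚ i → y ∈ ｛ x ｝ ∪ ｛ x′ ｝
      by-multiple (e , k≡ei) = by-index e
        (at-most-one 2≤i (subst (λ z → i ℕ.* z ℕ.+ i ℕ.* z ℕ.≤ i ℕ.* i ℕ.+ i ℕ.* i ℕ.+ z) k≡e*i (equal-index-bound {i = i} k≤m rel)))
        k≡e*i
        where
        k≡e*i : k ≡ e ℕ.* i
        k≡e*i = ℕ→ℚ-injective {m = k} {n = e ℕ.* i} (trans k≡ei (sym (ℕ→ℚ-homo-* e i)))

  indices-of-pair-products : A ⊆ ｛ x ｝ ∪ ｛ x′ ｝ → B ⊆ ｛ b ｝ ∪ ｛ b′ ｝ →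
    x * b ≡ v 0 → x′ * b′ ≡ v 1 → x * b′ ≡ v i → x′ * b ≡ v i →
    y ∈ A → c ∈ B → y * c ≡ v k → k ≡ 0 ⊎ k ≡ 1 ⊎ k ≡ i
  indices-of-pair-products {x = x} {x′ = x′} {b = b} {b′ = b′} {i = i} {k = k} A⊆ B⊆ xb x′b′ xb′ x′b y∈A c∈B yc =
    by-factors (A⊆ y∈A) (B⊆ c∈B) yc
    where
    by-factors : ∀ {y c} → y ∈ ｛ x ｝ ∪ ｛ x′ ｝ → c ∈ ｛ b ｝ ∪ ｛ b′ ｝ → y * c ≡ v k → k ≡ 0 ⊎ k ≡ 1 ⊎ k ≡ i
    by-factors (inj₁ refl) (inj₁ refl) yc = inj₁ (v-injective {i = k} {j = 0} (trans (sym yc) xb))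
    by-factors (inj₁ refl) (inj₂ refl) yc = inj₂ (inj₂ (v-injective {i = k} {j = i} (trans (sym yc) xb′)))
    by-factors (inj₂ refl) (inj₁ refl) yc = inj₂ (inj₂ (v-injective {i = k} {j = i} (trans (sym yc) x′b)))
    by-factors (inj₂ refl) (inj₂ refl) yc = inj₂ (inj₁ (v-injective {i = k} {j = 1} (trans (sym yc) x′b′)))

  two-not-root : Complementary i i → v 2 ≢ 0ℚ
  two-not-root {i = i} rel v2≡0 = no-root i (ℕ→ℚ-injective {m = i ℕ.* i ℕ.+ 2} {n = (i ℕ.+ i) ℕ.* 2} (begin
    ℕ→ℚ (i ℕ.* i ℕ.+ 2)          ≡⟨ trans (ℕ→ℚ-homo-+ (i ℕ.* i) 2) (cong (_+ ℕ→ℚ 2) (ℕ→ℚ-homo-* i i)) ⟩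
    ℕ→ℚ i * ℕ→ℚ i + ℕ→ℚ 2        ≡⟨ cong (ℕ→ℚ i * ℕ→ℚ i +_) (trans (sym (*-identityˡ (ℕ→ℚ 2))) (cong (1ℚ *_) (sym u≡2))) ⟩
    ℕ→ℚ i * ℕ→ℚ i + ℕ→ℚ 1 * u    ≡⟨ rel ⟩
    (ℕ→ℚ i + ℕ→ℚ i) * u          ≡⟨ cong ((ℕ→ℚ i + ℕ→ℚ i) *_) u≡2 ⟩
    (ℕ→ℚ i + ℕ→ℚ i) * ℕ→ℚ 2      ≡⟨ sym (trans (ℕ→ℚ-homo-* (i ℕ.+ i) 2) (cong (_* ℕ→ℚ 2) (ℕ→ℚ-homo-+ i i))) ⟩
    ℕ→ℚ ((i ℕ.+ i) ℕ.* 2)        ∎))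
    where
    open ≡-Reasoning
    u≡2 : u ≡ ℕ→ℚ 2
    u≡2 = x∙y⁻¹≈ε⇒x≈y u (ℕ→ℚ 2) v2≡0

  doubling-at-two : Complementary 2 2 → - (v 2 + v 2) ≡ v 0
  doubling-at-two = ≡-by-difference 1ℚ (solve 1 (λ u → :- ((u :- con two) :+ (u :- con two)) :- (u :- con 0ℚ)
    := con 1ℚ :* ((con two :* con two :+ con 1ℚ :* u) :- (con two :+ con two) :* u)) refl u)
    where
    two : ℚ
    two = ℕ→ℚ 2

module Cases {A B : Pred ℚ 0ℓ} {u : ℚ} {m : ℕ}
  (bound : ℕ→ℚ m ≤ u + u)
  (factors : (AP u (- 1ℚ) (suc m) ∖ ｛ 0ℚ ｝) ≐ (A ·ˢ B))
  (0<u : 0ℚ < u)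
  where

  open Core {A} {B} {u} {m} bound factors 0<u
  module Swap = Core {B} {A} {u} {m} bound (≐-trans factors (·ˢ-comm {A = A} {B = B})) 0<u

  equal-indices : x ∈ A → b ∈ B → x′ ∈ A → b′ ∈ B →
    x * b ≡ v 0 → x′ * b′ ≡ v 1 → x * b′ ≡ v i → x′ * b ≡ v i → i ℕ.≤ m → 2 ℕ.≤ i → Complementary i i → Conclusion A B
  equal-indices {x = x} {b = b} {x′ = x′} {b′ = b′} {i = i} x∈A b∈B x′∈A b′∈B xb x′b′ xb′ x′b i≤m 2≤i rel =
    by-index (i ℕ.≟ 2)
    where
    A⊆ : A ⊆ ｛ x ｝ ∪ ｛ x′ ｝
    A⊆ = equal {x = x} {i = i} {x′ = x′} b∈B b′∈B xb xb′ x′b 2≤i rel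
    B⊆ : B ⊆ ｛ b ｝ ∪ ｛ b′ ｝
    B⊆ = Swap.equal {x = b} {i = i} {x′ = b′} x∈A x′∈A (trans (*-comm b x) xb) (trans (*-comm b x′) x′b) (trans (*-comm b′ x) xb′) 2≤i rel
    third-value : i ≢ 2 → ∃[ y ] ∃[ c ] (y ∈ A × c ∈ B × y * c ≡ v 2) → ⊥
    third-value i≢2 (y , c , y∈A , c∈B , yc) = [ (λ ()) , [ (λ ()) , (λ 2≡i → i≢2 (sym 2≡i)) ]′ ]′
      (indices-of-pair-products {i = i} {k = 2} A⊆ B⊆ xb x′b′ xb′ x′b y∈A c∈B yc)
    by-index : Dec (i ≡ 2) → Conclusion A B
    by-index (yes i≡2) = conclusion-doubling
      (⊆-pair⇒≐-doubling-pair A⊆ x∈A x′∈A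
        (doubled-negative {x = x} {x′ = x′} (factor-nonzeroʳ x∈A b∈B) xb (trans x′b (cong v i≡2)) top))
      (⊆-pair⇒≐-doubling-pair B⊆ b∈B b′∈B
        (doubled-negative {x = b} {x′ = b′} (factor-nonzeroˡ x∈A b∈B) (trans (*-comm b x) xb) (trans (*-comm b′ x) (trans xb′ (cong v i≡2))) top))
      where
      top : - (v 2 + v 2) ≡ v 0
      top = doubling-at-two (subst (λ z → Complementary z z) i≡2 rel)
    by-index (no i≢2) = ⊥-elim (third-value i≢2 (factorisation {k = 2} (ℕ.≤-trans 2≤i i≤m) (two-not-root {i = i} rel)))

  distinct-factorisations : AtLeastTwo A → AtLeastTwo B → x ∈ A → b ∈ B → x′ ∈ A → b′ ∈ B → v 1 ≢ 0ℚ →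
    x * b ≡ v 0 → x′ * b′ ≡ v 1 → x′ ≢ x → b′ ≢ b → Conclusion A B
  distinct-factorisations {x = x} {b = b} {x′ = x′} {b′ = b′} twoA twoB x∈A b∈B x′∈A b′∈B v1≢0 xb x′b′ x′≢x b′≢b =
    at (product-index x∈A b′∈B) (product-index x′∈A b∈B)
    where
    at : NonzeroTerm (x * b′) → NonzeroTerm (x′ * b) → Conclusion A B
    at (i , i≤m , _ , xb′) (j , j≤m , _ , x′b) = by-position (adjacent-or-equal
        (complementary-bound {i = i} {j = j} i≤m rel)
        (complementary-bound {i = j} {j = i} j≤m (Complementary-sym {i = i} {j = j} rel)))
      where
      rel : Complementary i j
      rel = complementary {x = x} {b = b} {x′ = x′} {b′ = b′} {i = i} {j = j} xb x′b′ xb′ x′b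
      i≢0 : i ≢ 0
      i≢0 i≡0 = b′≢b (*-cancelˡ-≡ x (factor-nonzeroˡ x∈A b∈B) (trans xb′ (trans (cong v i≡0) (sym xb))))
      j≢0 : j ≢ 0
      j≢0 j≡0 = x′≢x (*-cancelʳ-≡ b (factor-nonzeroʳ x∈A b∈B) (trans x′b (trans (cong v j≡0) (sym xb))))
      by-position : j ≡ suc i ⊎ i ≡ suc j ⊎ i ≡ j → Conclusion A B
      by-position (inj₁ j≡1+i) = conclusion-±ˡ (⊆-pair∧two⇒≐
        (successive {x = x} {i = i} b∈B b′∈B xb xb′ i≢0 (subst (Complementary i) j≡1+i rel)) twoA)
      by-position (inj₂ (inj₁ i≡1+j)) = conclusion-±ʳ (⊆-pair∧two⇒≐
        (Swap.successive {x = b} {i = j} x∈A x′∈A (trans (*-comm b x) xb) (trans (*-comm b x′) x′b) j≢0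
          (subst (Complementary j) i≡1+j (Complementary-sym {i = i} {j = j} rel))) twoB)
      by-position (inj₂ (inj₂ i≡j)) =
        equal-indices {i = i} x∈A b∈B x′∈A b′∈B xb x′b′ xb′ (trans x′b (cong v (sym i≡j))) i≤m (≢0∧≢1⇒≥2 i≢0 i≢1) relᵢ
        where
        relᵢ : Complementary i i
        relᵢ = subst (Complementary i) (sym i≡j) rel
        i≢1 : i ≢ 1
        i≢1 i≡1 = v1≢0 (complementary-one {j = 1} (subst (λ z → Complementary z z) i≡1 relᵢ) λ ())

  from-two-factorisations : AtLeastTwo A → AtLeastTwo B → x ∈ A → b ∈ B → x′ ∈ A → b′ ∈ B → v 1 ≢ 0ℚ →
    x * b ≡ v 0 → x′ * b′ ≡ v 1 → Conclusion A B
  from-two-factorisations {x = x} {b = b} {x′ = x′} {b′ = b′} twoA twoB x∈A b∈B x′∈A b′∈B v1≢0 xb x′b′ =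
    compare (x′ ≟ x) (b′ ≟ b)
    where
    compare : Dec (x′ ≡ x) → Dec (b′ ≡ b) → Conclusion A B
    compare (yes x′≡x) _ = conclusion-±ˡ (⊆-pair∧two⇒≐
      (shared {x = x} b∈B b′∈B xb (subst (λ z → z * b′ ≡ v 1) x′≡x x′b′)) twoA)
    compare (no _) (yes b′≡b) = conclusion-±ʳ (⊆-pair∧two⇒≐
      (Swap.shared {x = b} x∈A x′∈A (trans (*-comm b x) xb) (trans (*-comm b x′) (subst (λ z → x′ * z ≡ v 1) b′≡b x′b′))) twoB)
    compare (no x′≢x) (no b′≢b) = distinct-factorisations twoA twoB x∈A b∈B x′∈A b′∈B v1≢0 xb x′b′ x′≢x b′≢b

  conclusion : AtLeastTwo A → AtLeastTwo B → Conclusion A B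
  conclusion twoA twoB = from-top (factorisation {k = 0} z≤n v0≢0)
    where
    v0≢0 : v 0 ≢ 0ℚ
    v0≢0 v0≡0 = <-irrefl (sym (trans (sym (+-identityʳ u)) v0≡0)) 0<u
    from-top : ∃[ x ] ∃[ b ] (x ∈ A × b ∈ B × x * b ≡ v 0) → Conclusion A B
    from-top (x , b , x∈A , b∈B , xb) = by-v1 (v 1 ≟ 0ℚ)
      where
      by-v1 : Dec (v 1 ≡ 0ℚ) → Conclusion A B
      by-v1 (yes v1≡0) = conclusion-±ˡ (⊆-pair∧two⇒≐ (degenerate {x = x} b∈B xb v1≡0) twoA)
      by-v1 (no v1≢0) = let x′ , b′ , x′∈A , b′∈B , x′b′ = factorisation (1≤m twoA b∈B) v1≢0
                        in from-two-factorisations twoA twoB x∈A b∈B x′∈A b′∈B v1≢0 xb x′b′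

unit-progression : ℕ→ℚ m ≤ u + u → (AP u (- 1ℚ) (suc m) ∖ ｛ 0ℚ ｝) ≐ (A ·ˢ B) →
                   AtLeastTwo A → AtLeastTwo B → Conclusion A B
unit-progression {m = m} {u = u} {A = A} {B = B} bound factors twoA@(y , _ , y∈A , _) twoB@(c , _ , c∈B , _) =
  Cases.conclusion {A} {B} {u} {m} bound factors (Indexing.u-positive {A} {B} {u} {m} bound factors y∈A c∈B) twoA twoB

lemma1 : (P A B : Pred ℚ 0ℓ) → IsFiniteAP P → (P ∖ ｛ 0ℚ ｝) ≐ (A ·ˢ B) →
    AtLeastTwo A → AtLeastTwo B →
    ∃[ r ] ∃[ r₁ ] ∃[ r₂ ]
      ((A ≐ (｛ - r₁ ｝ ∪ ｛ (1ℚ + 1ℚ) * r₁ ｝) × B ≐ (｛ - r₂ ｝ ∪ ｛ (1ℚ + 1ℚ) * r₂ ｝))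
       ⊎ (A ≐ (｛ - r ｝ ∪ ｛ r ｝) ⊎ B ≐ (｛ - r ｝ ∪ ｛ r ｝)))
lemma1 P A B (a , d , n , P≐AP) P∖0≐AB twoA twoB =
  let μ , u , m , μ≢0 , bound , factors = normalise {a = a} {d = d} {n = n} twoA twoB (≐-trans (∖-congˡ (≐-sym P≐AP)) P∖0≐AB)
  in Conclusion-⊙ {μ = μ} {A = A} {B = B} μ≢0 (unit-progression {m = m} {u = u} {A = μ ⊙ A} {B = B} bound factors (⊙-AtLeastTwo μ≢0 twoA) twoB)
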